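{- Let $n \geq m \geq 2$ and let $K_{n,m}$ be the complete bipartite graph with bipartition $(X,Y)$, where $|X|=n$ and $|Y|=m$. If $U$ is a strong edge geodetic set of $K_{n,m}$ and $Y \subseteq U$, then $|U| \geq n+1$.
   Context: All graphs are finite and simple. For a graph $G$, a set $S\subseteq V(G)$ is a strong edge geodetic set if to each (unordered) pair of vertices $u,v\in S$ one can assign one shortest $u,v$-path (or no path) such that every edge of $G$ lies on at least one of the assigned paths. -}

module Defs where

open import Data.Nat using (ℕ; zero; suc; _+_; _≤_)
open import Data.Fin using (Fin; toℕ; splitAt) renaming (_<_ to _<ᶠ_)
open import Data.Fin.Subset using (Subset; _∈_)
open import Data.Bool using (Bool; true; false; T; _xor_)
open import Data.Sum using (_⊎_; inj₁; inj₂)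
open import Data.Product using (Σ; _×_; _,_; ∃-syntax)
open import Data.Maybe using (Maybe; just)
open import Relation.Binary.PropositionalEquality using (_≡_; refl)
open import Relation.Nullary using (¬_)

record Graph (N : ℕ) : Set₁ where
  field
    Adj   : Fin N → Fin N → Set
    sym   : ∀ {x y} → Adj x y → Adj y x
    irrefl : ∀ {x} → ¬ Adj x x
open Graph public

data Walk {N : ℕ} (G : Graph N) : Fin N → Fin N → ℕ → Set where
  nil  : ∀ {u} → Walk G u u 0
  cons : ∀ {u w v k} → Adj G u w → Walk G w v k → Walk G u v (suc k)

-- A shortest u,v-path: a walk of length k from u to v such that every
-- u,v-walk has length at least k (a shortest walk is necessarily a path).
ShortestPath : ∀ {N} → Graph N → Fin N → Fin N → Set
ShortestPath G u v =
  Σ ℕ λ k → Σ (Walk G u v k) λ _ → ∀ k′ → Walk G u v k′ → k ≤ k′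

data EdgeOnWalk {N : ℕ} {G : Graph N} (x y : Fin N)
     : ∀ {u v k} → Walk G u v k → Set where
  here  : ∀ {u w v k} (a : Adj G u w) (p : Walk G w v k) →
          (u ≡ x × w ≡ y) ⊎ (u ≡ y × w ≡ x) → EdgeOnWalk x y (cons a p)
  there : ∀ {u w v k} (a : Adj G u w) (p : Walk G w v k) →
          EdgeOnWalk x y p → EdgeOnWalk x y (cons a p)

EdgeOnPath : ∀ {N} {G : Graph N} (x y : Fin N) {u v : Fin N} →
             ShortestPath G u v → Set
EdgeOnPath x y (k , p , _) = EdgeOnWalk x y p

-- Strong edge geodetic set: to each unordered pair {u,v} of distinct
-- vertices of S (represented by toℕ u < toℕ v) one assigns one shortest
-- u,v-path or no path (Maybe), such that every edge of G lies on at least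
-- one assigned path.
IsStrongEdgeGeodetic : ∀ {N} → Graph N → Subset N → Set
IsStrongEdgeGeodetic {N} G S =
  Σ ((u v : Fin N) → u <ᶠ v → u ∈ S → v ∈ S → Maybe (ShortestPath G u v)) λ A →
    ∀ x y → Adj G x y →
      ∃[ u ] ∃[ v ] Σ (u <ᶠ v) λ lt → Σ (u ∈ S) λ uS → Σ (v ∈ S) λ vS →
        Σ (ShortestPath G u v) λ P → (A u v lt uS vS ≡ just P) × EdgeOnPath x y P

-- Complete bipartite graph K_{n,m} on Fin (n + m):
-- X = first n vertices (inject+), Y = last m vertices (raise n).
inX : (n : ℕ) {m : ℕ} → Fin (n + m) → Bool
inX n i with splitAt n i
... | inj₁ _ = true
... | inj₂ _ = false

private
  xor-comm : ∀ a b → T (a xor b) → T (b xor a)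
  xor-comm true true t = t
  xor-comm true false t = t
  xor-comm false true t = t
  xor-comm false false t = t

  xor-self : ∀ a → ¬ T (a xor a)
  xor-self true ()
  xor-self false ()

K : (n m : ℕ) → Graph (n + m)
K n m = record
  { Adj = λ i j → T (inX n i xor inX n j)
  ; sym = λ {i} {j} → xor-comm (inX n i) (inX n j)
  ; irrefl = λ {i} → xor-self (inX n i)
  }

-- Fix a vertex y₀ of Y. For every x ∈ X outside U, the edge x y₀ lies on an
-- assigned geodesic between two vertices of U; geodesics of K_{n,m} have
-- length at most 2 and x is not an end, so this geodesic is y₀ – x – y for
-- some y ∈ Y ∖ {y₀}. The pair {y₀, y} carries only one assigned geodesic,
-- hence only one middle vertex, so x ↦ y is injective and at most m − 1
-- vertices of X lie outside U. Thus |U| ≥ (n − (m − 1)) + m = n + 1.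
module Submission where

open import Defs hiding (sym)
open import Data.Nat using (ℕ; zero; suc; _+_; _≤_; z≤n; s≤s)
open import Data.Nat.Properties
  using (≤-trans; ≤-refl; +-suc; +-comm; +-cancelʳ-≤; +-monoˡ-≤; m∸n+n≡m; module ≤-Reasoning)
open import Data.Fin using (Fin; zero; suc; _↑ʳ_; splitAt; join; punchOut) renaming (_<_ to _<ᶠ_)
open import Data.Fin.Properties using (0≢1+n; suc-injective; punchOut-injective; join-splitAt; splitAt-↑ʳ; <-asym; <-irrefl; <-irrelevant)
open import Data.Fin.Subset using (Subset; _∈_; _∉_; ∣_∣; ∁; inside; outside)
open import Data.Fin.Subset.Properties using (∣∁p∣≡n∸∣p∣; ∣p∣≤n; x∈∁p⇒x∉p)
open import Data.Vec using ([]; _∷_)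
open import Data.Vec.Base using (here; there)
open import Data.Vec.Properties.WithK using ([]=-irrelevant)
open import Data.Bool using (true; false)
open import Data.Sum using (_⊎_; inj₁; inj₂)
open import Data.Product using (_×_; _,_; proj₁; proj₂; ∃-syntax)
open import Data.Maybe using (Maybe; just)
open import Data.Maybe.Properties using (just-injective)
open import Data.Empty using (⊥-elim)
open import Relation.Binary.PropositionalEquality
  using (_≡_; _≢_; refl; sym; trans; cong; subst; module ≡-Reasoning)

injective⇒∣p∣≤ : ∀ {k c} (p : Subset k) (f : ∀ i → i ∈ p → Fin c) →
  (∀ {i j} (i∈p : i ∈ p) (j∈p : j ∈ p) → f i i∈p ≡ f j j∈p → i ≡ j) →
  ∣ p ∣ ≤ c
injective⇒∣p∣≤ [] f inj = z≤n
injective⇒∣p∣≤ (outside ∷ p) f inj =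
  injective⇒∣p∣≤ p (λ i i∈p → f (suc i) (there i∈p))
    (λ i∈p j∈p eq → suc-injective (inj (there i∈p) (there j∈p) eq))
injective⇒∣p∣≤ {c = zero} (inside ∷ p) f inj with f zero here
... | ()
injective⇒∣p∣≤ {c = suc c} (inside ∷ p) f inj =
  s≤s (injective⇒∣p∣≤ p (λ i i∈p → punchOut (f₀≢ i∈p))
    (λ i∈p j∈p eq → suc-injective
      (inj (there i∈p) (there j∈p) (punchOut-injective (f₀≢ i∈p) (f₀≢ j∈p) eq))))
  where
  f₀≢ : ∀ {i} (i∈p : i ∈ p) → f zero here ≢ f (suc i) (there i∈p)
  f₀≢ i∈p eq = 0≢1+n (inj here (there i∈p) eq)

∣∁p∣+∣p∣≡n : ∀ {n} (p : Subset n) → ∣ ∁ p ∣ + ∣ p ∣ ≡ n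
∣∁p∣+∣p∣≡n p = trans (cong (_+ ∣ p ∣) (∣∁p∣≡n∸∣p∣ p)) (m∸n+n≡m (∣p∣≤n p))

module _ {N : ℕ} where

  SamePair : (u v a b : Fin N) → Set
  SamePair u v a b = (u ≡ a × v ≡ b) ⊎ (u ≡ b × v ≡ a)

  samePair-<-unique : ∀ {u₁ v₁ u₂ v₂ a b} → u₁ <ᶠ v₁ → u₂ <ᶠ v₂ →
    SamePair u₁ v₁ a b → SamePair u₂ v₂ a b → u₁ ≡ u₂ × v₁ ≡ v₂
  samePair-<-unique _ _ (inj₁ (refl , refl)) (inj₁ (refl , refl)) = refl , refl
  samePair-<-unique _ _ (inj₂ (refl , refl)) (inj₂ (refl , refl)) = refl , refl
  samePair-<-unique u₁<v₁ u₂<v₂ (inj₁ (refl , refl)) (inj₂ (refl , refl)) = ⊥-elim (<-asym u₁<v₁ u₂<v₂)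
  samePair-<-unique u₁<v₁ u₂<v₂ (inj₂ (refl , refl)) (inj₁ (refl , refl)) = ⊥-elim (<-asym u₁<v₁ u₂<v₂)

  samePair-<⇒≢ : ∀ {u v a b} → u <ᶠ v → SamePair u v a b → a ≢ b
  samePair-<⇒≢ u<v (inj₁ (refl , refl)) refl = <-irrefl refl u<v
  samePair-<⇒≢ u<v (inj₂ (refl , refl)) refl = <-irrefl refl u<v

module _ {N : ℕ} {G : Graph N} where

  -- Junk value u for the empty walk.
  secondVertex : ∀ {u v k} → Walk G u v k → Fin N
  secondVertex {u = u} nil = u
  secondVertex (cons {w = w} _ _) = w

  pathSecondVertex : ∀ {u v} → ShortestPath G u v → Fin N
  pathSecondVertex (_ , w , _) = secondVertex w

  edgeOnWalk≤2 : ∀ {u v k x y} (w : Walk G u v k) → k ≤ 2 → x ≢ u → x ≢ v →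
    EdgeOnWalk x y w → secondVertex w ≡ x × ∃[ z ] Adj G x z × SamePair u v y z
  edgeOnWalk≤2 (cons a nil) _ x≢u _ (here _ _ (inj₁ (u≡x , _))) = ⊥-elim (x≢u (sym u≡x))
  edgeOnWalk≤2 (cons a nil) _ _ x≢v (here _ _ (inj₂ (_ , v≡x))) = ⊥-elim (x≢v (sym v≡x))
  edgeOnWalk≤2 (cons a (cons b nil)) _ x≢u _ (here _ _ (inj₁ (u≡x , _))) = ⊥-elim (x≢u (sym u≡x))
  edgeOnWalk≤2 {v = v} (cons a (cons b nil)) _ _ _ (here _ _ (inj₂ (u≡y , refl))) =
    refl , v , b , inj₁ (u≡y , refl)
  edgeOnWalk≤2 {u = u} (cons a (cons b nil)) _ _ _ (there _ _ (here _ _ (inj₁ (refl , v≡y)))) =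
    refl , u , Graph.sym G a , inj₂ (refl , v≡y)
  edgeOnWalk≤2 (cons a (cons b nil)) _ _ x≢v (there _ _ (here _ _ (inj₂ (_ , v≡x)))) = ⊥-elim (x≢v (sym v≡x))
  edgeOnWalk≤2 (cons _ (cons _ (cons _ _))) (s≤s (s≤s ())) _ _ _

  assigned-unique : ∀ {S : Subset N}
    (A : (u v : Fin N) → u <ᶠ v → u ∈ S → v ∈ S → Maybe (ShortestPath G u v))
    {u v} {P Q : ShortestPath G u v} (u<v u<v′ : u <ᶠ v) (u∈S u∈S′ : u ∈ S) (v∈S v∈S′ : v ∈ S) →
    A u v u<v u∈S v∈S ≡ just P → A u v u<v′ u∈S′ v∈S′ ≡ just Q → P ≡ Q
  assigned-unique A u<v u<v′ u∈S u∈S′ v∈S v∈S′ eqP eqQ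
    rewrite <-irrelevant u<v u<v′ | []=-irrelevant u∈S u∈S′ | []=-irrelevant v∈S v∈S′ =
      just-injective (trans (sym eqP) eqQ)

module _ {n m : ℕ} where

  inX≡false⇒↑ʳ : (i : Fin (n + m)) → inX n i ≡ false → ∃[ j ] n ↑ʳ j ≡ i
  inX≡false⇒↑ʳ i eq with splitAt n {m} i in split
  ... | inj₂ j = j , trans (cong (join n m) (sym split)) (join-splitAt n m i)

  inX-↑ʳ : (j : Fin m) → inX n (n ↑ʳ j) ≡ false
  inX-↑ʳ j rewrite splitAt-↑ʳ n m j = refl

  adjX⇒inX≡false : ∀ {a b : Fin (n + m)} → inX n a ≡ true → Adj (K n m) a b → inX n b ≡ false
  adjX⇒inX≡false {a} {b} eqa ab with inX n a | inX n b
  adjX⇒inX≡false refl _ | true | false = refl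

  adj-K : ∀ {a b : Fin (n + m)} → inX n a ≡ true → inX n b ≡ false → Adj (K n m) a b
  adj-K eqa eqb rewrite eqa | eqb = _

  shortestPath-K-length≤2 : ∀ {x y u v : Fin (n + m)} → inX n x ≡ true → inX n y ≡ false →
    (P : ShortestPath (K n m) u v) → proj₁ P ≤ 2
  shortestPath-K-length≤2 {u = u} {v} x∈X y∈Y (_ , _ , minimal) =
    ≤-trans (minimal _ (proj₂ (proj₂ shortWalk))) (proj₁ (proj₂ shortWalk))
    where
    shortWalk : ∃[ l ] l ≤ 2 × Walk (K n m) u v l
    shortWalk with inX n u in eu | inX n v in ev
    ... | true  | true  = 2 , ≤-refl , cons (adj-K eu y∈Y) (cons (Graph.sym (K n m) (adj-K ev y∈Y)) nil)
    ... | true  | false = 1 , s≤s z≤n , cons (adj-K eu ev) nil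
    ... | false | true  = 1 , s≤s z≤n , cons (Graph.sym (K n m) (adj-K ev eu)) nil
    ... | false | false = 2 , ≤-refl , cons (Graph.sym (K n m) (adj-K x∈X eu)) (cons (adj-K x∈X ev) nil)

module MissedVertices (n c : ℕ) (U : Subset (n + suc c))
  (geodetic : IsStrongEdgeGeodetic (K n (suc c)) U) (Y⊆U : ∀ j → (n ↑ʳ j) ∈ U) where

  private
    G : Graph (n + suc c)
    G = K n (suc c)

    y₀ : Fin (n + suc c)
    y₀ = n ↑ʳ zero

    A = proj₁ geodetic

  ∉U⇒inX : ∀ {x} → x ∉ U → inX n x ≡ true
  ∉U⇒inX {x} x∉U with inX n x in eq
  ... | true = refl
  ... | false with inX≡false⇒↑ʳ x eq
  ...   | j , refl = ⊥-elim (x∉U (Y⊆U j))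

  record Cover (x : Fin (n + suc c)) : Set where
    field
      {u v} : Fin (n + suc c)
      u<v : u <ᶠ v
      u∈U : u ∈ U
      v∈U : v ∈ U
      path : ShortestPath G u v
      assigned : A u v u<v u∈U v∈U ≡ just path
      through : pathSecondVertex path ≡ x
      other : Fin (suc c)
      other≢0 : zero ≢ other
      pair : SamePair u v y₀ (n ↑ʳ other)

  cover : ∀ {x} → x ∉ U → Cover x
  cover {x} x∉U
    with proj₂ geodetic x y₀ (adj-K (∉U⇒inX x∉U) (inX-↑ʳ zero))
  ... | u , v , u<v , u∈U , v∈U , P@(_ , w , _) , assigned , onP
    with edgeOnWalk≤2 w (shortestPath-K-length≤2 (∉U⇒inX x∉U) (inX-↑ʳ zero) P)
           (λ { refl → x∉U u∈U }) (λ { refl → x∉U v∈U }) onP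
  ... | through , z , xz , pair
    with inX≡false⇒↑ʳ z (adjX⇒inX≡false (∉U⇒inX x∉U) xz)
  ... | j , refl = record
    { u<v = u<v ; u∈U = u∈U ; v∈U = v∈U ; path = P ; assigned = assigned
    ; through = through ; other = j
    ; other≢0 = λ { refl → samePair-<⇒≢ u<v pair refl }
    ; pair = pair
    }

  cover-injective : ∀ {x₁ x₂} (C₁ : Cover x₁) (C₂ : Cover x₂) →
    Cover.other C₁ ≡ Cover.other C₂ → x₁ ≡ x₂
  cover-injective {x₁} {x₂} C₁ C₂ same-other
    with samePair-<-unique (Cover.u<v C₁) (Cover.u<v C₂) (Cover.pair C₁)
           (subst (λ j → SamePair _ _ y₀ (n ↑ʳ j)) (sym same-other) (Cover.pair C₂))
  ... | refl , refl = begin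
      x₁                                ≡⟨ sym (Cover.through C₁) ⟩
      pathSecondVertex (Cover.path C₁)  ≡⟨ cong pathSecondVertex same-path ⟩
      pathSecondVertex (Cover.path C₂)  ≡⟨ Cover.through C₂ ⟩
      x₂                                ∎
    where
    open ≡-Reasoning
    same-path : Cover.path C₁ ≡ Cover.path C₂
    same-path = assigned-unique A (Cover.u<v C₁) (Cover.u<v C₂) (Cover.u∈U C₁) (Cover.u∈U C₂)
      (Cover.v∈U C₁) (Cover.v∈U C₂) (Cover.assigned C₁) (Cover.assigned C₂)

  ∣∁U∣≤c : ∣ ∁ U ∣ ≤ c
  ∣∁U∣≤c = injective⇒∣p∣≤ (∁ U) (λ x x∈∁U → punchOut (other≢0 x∈∁U))
    λ x₁∈∁U x₂∈∁U eq → cover-injective (cover′ x₁∈∁U) (cover′ x₂∈∁U)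
      (punchOut-injective (other≢0 x₁∈∁U) (other≢0 x₂∈∁U) eq)
    where
    cover′ : ∀ {x} → x ∈ ∁ U → Cover x
    cover′ x∈∁U = cover (x∈∁p⇒x∉p x∈∁U)
    other≢0 : ∀ {x} (x∈∁U : x ∈ ∁ U) → zero ≢ Cover.other (cover′ x∈∁U)
    other≢0 x∈∁U = Cover.other≢0 (cover′ x∈∁U)

lemma2p3 : (n m : ℕ) → 2 ≤ m → m ≤ n → (U : Subset (n + m)) →
    IsStrongEdgeGeodetic (K n m) U →
    (∀ (j : Fin m) → (n ↑ʳ j) ∈ U) →
    suc n ≤ ∣ U ∣
lemma2p3 n (suc c) _ _ U geodetic Y⊆U = +-cancelʳ-≤ c (suc n) ∣ U ∣ (begin
  suc n + c         ≡⟨ sym (+-suc n c) ⟩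
  n + suc c         ≡⟨ sym (∣∁p∣+∣p∣≡n U) ⟩
  ∣ ∁ U ∣ + ∣ U ∣   ≤⟨ +-monoˡ-≤ ∣ U ∣ (MissedVertices.∣∁U∣≤c n c U geodetic Y⊆U) ⟩
  c + ∣ U ∣         ≡⟨ +-comm c ∣ U ∣ ⟩
  ∣ U ∣ + c         ∎)
  where open ≤-Reasoning
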